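{- Let $R$ be a principal ideal domain with field of fractions $K$, let $q\in R$ be a prime, and let $\psi$ be a specialization of $\mathcal{A}_{k,n}$ with $p_{i_1,\ldots,i_k}:=\psi(t_{i_1,\ldots,i_k})\in R\setminus\{0\}$ for all $1\le i_1<\cdots<i_k\le n$. Assume there is $m$ with $\nu_q(p_{i_1,\ldots,i_k})=m$ for all $1\le i_1<\cdots<i_k\le n$. Then \[ \binom{n}{k-1}\le |\mathbb{P}(R/(q))^k|. \]
   Context: Let $K$ be a field, $T=K[t_{i_1,\ldots,i_k}\mid 1\le i_1<\cdots<i_k\le n]$, and let $p:T\to K[x_{i,j}\mid 1\le i\le k, 1\le j\le n]$ send $t_{i_1,\ldots,i_k}$ to the determinant of the submatrix of the generic $k\times n$ matrix formed by columns $i_1,\ldots,i_k$; set $\mathcal{A}_{k,n}:=T/\ker(p)$. A specialization is a $K$-algebra homomorphism $\psi:\mathcal{A}_{k,n}\to K$. $\nu_q(a)$ is the largest $m\ge 0$ with $a\in(q^m)$. $|\mathbb{P}(F)^k|$ denotes the number of one-dimensional subspaces of $F^k$, for the field $F=R/(q)$. -}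

module Defs where

open import Level using (Level; _⊔_) renaming (suc to lsuc)
open import Algebra.Bundles using (CommutativeRing)
open import Data.Nat as ℕ using (ℕ; zero; suc)
open import Data.Fin as Fin using (Fin; zero; suc; punchIn)
open import Data.Product using (Σ; ∃; _×_; _,_; proj₁)
open import Data.Sum using (_⊎_)
open import Relation.Nullary using (¬_)
open import Relation.Binary.PropositionalEquality using (_≡_)

-- Strictly increasing k-tuples 1 ≤ i₁ < ⋯ < i_k ≤ n, i.e. the index set
-- of the Plücker variables t_{i₁,…,i_k}.
Inc : ℕ → ℕ → Set
Inc k n = Σ (Fin k → Fin n) (λ s → ∀ (i j : Fin k) → i Fin.< j → s i Fin.< s j)

-- Polynomial expressions with coefficients in A and variables in V
-- (elements of the polynomial ring A[V], represented syntactically).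
data Expr {a} (A : Set a) (V : Set) : Set a where
  con  : A → Expr A V
  var  : V → Expr A V
  _⊕_  : Expr A V → Expr A V → Expr A V
  _⊗_  : Expr A V → Expr A V → Expr A V
  ⊝_   : Expr A V → Expr A V

module RingDefs {c ℓ} (R : CommutativeRing c ℓ) where
  open CommutativeRing R hiding (zero)

  eval : ∀ {V} → (V → Carrier) → Expr Carrier V → Carrier
  eval ρ (con a)  = a
  eval ρ (var v)  = ρ v
  eval ρ (e ⊕ f)  = eval ρ e + eval ρ f
  eval ρ (e ⊗ f)  = eval ρ e * eval ρ f
  eval ρ (⊝ e)    = - eval ρ e

  sumFin : ∀ k → (Fin k → Carrier) → Carrier
  sumFin zero    f = 0#
  sumFin (suc k) f = f zero + sumFin k (λ j → f (suc j))

  sign : ℕ → Carrier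
  sign zero    = 1#
  sign (suc j) = - sign j

  det : ∀ k → (Fin k → Fin k → Carrier) → Carrier
  det zero    M = 1#
  det (suc k) M = sumFin (suc k) (λ j →
      sign (Fin.toℕ j) * (M zero j * det k (λ i l → M (suc i) (punchIn j l))))

  minor : ∀ {k n} → (Fin k → Fin n → Carrier) → Inc k n → Carrier
  minor {k} X (s , _) = det k (λ i l → X i (s l))

  pow : Carrier → ℕ → Carrier
  pow x zero    = 1#
  pow x (suc m) = x * pow x m

  _∣_ : Carrier → Carrier → Set (c ⊔ ℓ)
  a ∣ b = ∃ λ d → b ≈ d * a

  IsUnit : Carrier → Set (c ⊔ ℓ)
  IsUnit u = ∃ λ v → u * v ≈ 1#

  record IsIntegralDomain : Set (c ⊔ ℓ) where
    field
      1≉0        : ¬ (1# ≈ 0#)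
      noZeroDiv  : ∀ a b → a * b ≈ 0# → a ≈ 0# ⊎ b ≈ 0#

  record IsIdeal (I : Carrier → Set (c ⊔ ℓ)) : Set (c ⊔ ℓ) where
    field
      resp  : ∀ {a b} → a ≈ b → I a → I b
      has0  : I 0#
      +-cl  : ∀ {a b} → I a → I b → I (a + b)
      *-cl  : ∀ r {a} → I a → I (r * a)

  IsPrincipal : (Carrier → Set (c ⊔ ℓ)) → Set (c ⊔ ℓ)
  IsPrincipal I = ∃ λ g → ∀ x → (I x → g ∣ x) × (g ∣ x → I x)

  record IsPID : Set (lsuc (c ⊔ ℓ)) where
    field
      isIntegralDomain : IsIntegralDomain
      principal        : ∀ I → IsIdeal I → IsPrincipal I

  record IsPrime (q : Carrier) : Set (c ⊔ ℓ) where
    field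
      nonzero   : ¬ (q ≈ 0#)
      nonunit   : ¬ IsUnit q
      divides   : ∀ a b → q ∣ (a * b) → q ∣ a ⊎ q ∣ b

  ValEq : Carrier → Carrier → ℕ → Set (c ⊔ ℓ)
  ValEq q a m = (pow q m ∣ a) × (∀ m′ → pow q m′ ∣ a → m′ ℕ.≤ m)

  -- Points of ℙ(R/(q))^k, via representatives: vectors in R^k whose reduction
  -- mod q is nonzero, with v ~ w iff v ≡ λ w (mod q) for some λ invertible mod q.
  NonzeroModq : ∀ {k} → Carrier → (Fin k → Carrier) → Set (c ⊔ ℓ)
  NonzeroModq q v = ∃ λ i → ¬ (q ∣ v i)

  SameLineModq : ∀ {k} → Carrier → (Fin k → Carrier) → (Fin k → Carrier) → Set (c ⊔ ℓ)
  SameLineModq q v w = ∃ λ λ′ → ¬ (q ∣ λ′) × (∀ i → q ∣ (v i - λ′ * w i))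

  -- N ≤ |ℙ(R/(q))^k| : there are N pairwise distinct points of ℙ(R/(q))^k,
  -- i.e. an injection Fin N → ℙ(R/(q))^k.
  AtLeastProjPoints : Carrier → ℕ → ℕ → Set (c ⊔ ℓ)
  AtLeastProjPoints q k N =
    Σ (Fin N → Fin k → Carrier) λ L →
      (∀ a → NonzeroModq q (L a)) ×
      (∀ a b → SameLineModq q (L a) (L b) → a ≡ b)

record IsFractionField {c ℓ c′ ℓ′} (R : CommutativeRing c ℓ) (K : CommutativeRing c′ ℓ′)
       (ι : CommutativeRing.Carrier R → CommutativeRing.Carrier K) : Set (c ⊔ ℓ ⊔ c′ ⊔ ℓ′) where
  private
    module R = CommutativeRing R
    module K = CommutativeRing K
  field
    ι-cong   : ∀ {a b} → a R.≈ b → ι a K.≈ ι b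
    ι-inj    : ∀ {a b} → ι a K.≈ ι b → a R.≈ b
    ι-+      : ∀ a b → ι (a R.+ b) K.≈ ι a K.+ ι b
    ι-*      : ∀ a b → ι (a R.* b) K.≈ ι a K.* ι b
    ι-1      : ι R.1# K.≈ K.1#
    K-1≉0    : ¬ (K.1# K.≈ K.0#)
    K-inv    : ∀ x → ¬ (x K.≈ K.0#) → ∃ λ y → x K.* y K.≈ K.1#
    fraction : ∀ x → ∃ λ a → ∃ λ b → ¬ (b R.≈ R.0#) × (x K.* ι b K.≈ ι a)

-- Write p = qᵐ p′ with q ∤ p′(I) for every I, and fix an increasing k-tuple B of columns.
-- The quadratic Plücker relations hold for the maximal minors of every matrix (expand a
-- determinant with two equal rows), so they hold for the specialization p, and, being
-- homogeneous, for p′ since R is a domain. For a (k−1)-subset S of columns let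
-- v_S = (±p′(S ∪ {Bᵢ}))ᵢ ∈ Rᵏ; it is nonzero mod q because some Bᵢ lies outside S. The
-- Plücker relation for S and the k+1 columns j ∷ B says that p′(B) · (±p′(S ∪ {j})) is a
-- linear form in v_S whose coefficients depend only on j and B. As q ∤ p′(B), if
-- v_S ≡ λ v_S′ (mod q) then p′(S ∪ {j}) ≡ ±λ p′(S′ ∪ {j}) for every column j; for j in exactly
-- one of S, S′ one side vanishes and the other does not. Hence the C(n, k−1) subsets S give
-- pairwise distinct points of ℙ(R/(q))ᵏ. (If k > n, then C(n, k−1) ≤ 1 and one point suffices.)

module Submission where

open import Defs
open import Algebra.Bundles using (CommutativeRing)
open import Algebra.Morphism.Structures using (IsRingHomomorphism)
open import Data.Nat as ℕ using (ℕ; zero; suc; z≤n; s≤s; _≤_; _∸_)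
import Data.Nat.Properties as ℕₚ
open import Data.Nat.Combinatorics using (_C_; nCk+nC[k+1]≡[n+1]C[k+1])
open import Data.Fin as Fin using (Fin; zero; suc; toℕ; punchIn; splitAt; _↑ˡ_; _↑ʳ_)
import Data.Fin.Properties as Finₚ
open import Data.Vec.Functional using (_∷_; tail)
open import Data.Vec.Functional.Relation.Unary.Any using (Any; any; there)
open import Data.Product as Prod using (∃; _×_; _,_; proj₁; proj₂)
open import Data.Sum as Sum using (_⊎_; inj₁; inj₂)
open import Function using (_∘_)
open import Relation.Nullary using (¬_; Dec; yes; no; contradiction)
open import Relation.Binary.PropositionalEquality as ≡ using (_≡_; _≢_)

module Tuples where
  open ≡ using (refl)

  Increasing : ∀ {r n} → (Fin r → Fin n) → Set
  Increasing s = ∀ i j → i Fin.< j → s i Fin.< s j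

  increasing₁ : ∀ {n} (s : Fin 1 → Fin n) → Increasing s
  increasing₁ s zero zero ()

  ∷-increasing : ∀ {r n} {a : Fin n} {T : Fin r → Fin n} →
                 (∀ l → a Fin.< T l) → Increasing T → Increasing (a ∷ T)
  ∷-increasing a<T incT zero    zero    ()
  ∷-increasing a<T incT zero    (suc j) _       = a<T j
  ∷-increasing a<T incT (suc i) zero    ()
  ∷-increasing a<T incT (suc i) (suc j) (s≤s p) = incT i j p

  tail-increasing : ∀ {r n} {T : Fin (suc r) → Fin n} → Increasing T → Increasing (tail T)
  tail-increasing incT i j p = incT (suc i) (suc j) (s≤s p)

  suc-increasing : ∀ {r n} {T : Fin r → Fin n} → Increasing T → Increasing (suc ∘ T)
  suc-increasing incT i j p = s≤s (incT i j p)

  punchIn-increasing : ∀ {m} (c : Fin (suc m)) → Increasing (punchIn c)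
  punchIn-increasing zero    i       j       p       = s≤s p
  punchIn-increasing (suc c) zero    (suc j) p       = s≤s z≤n
  punchIn-increasing (suc c) (suc i) (suc j) (s≤s p) = s≤s (punchIn-increasing c i j p)

  <head⇒<all : ∀ {r n} {v : Fin n} {T : Fin (suc r) → Fin n} →
               Increasing T → v Fin.< T zero → ∀ l → v Fin.< T l
  <head⇒<all incT v<T₀ zero    = v<T₀
  <head⇒<all incT v<T₀ (suc l) = ℕₚ.<-trans v<T₀ (incT zero (suc l) (s≤s z≤n))

  _∈ᵛ_ : ∀ {r n} → Fin n → (Fin r → Fin n) → Set
  j ∈ᵛ T = Any (_≡ j) T

  _∈ᵛ?_ : ∀ {r n} (j : Fin n) (T : Fin r → Fin n) → Dec (j ∈ᵛ T)
  j ∈ᵛ? T = any (Finₚ._≟ j) T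

  rotate : ∀ {k} → Fin (suc k) → Fin (suc k) → Fin (suc k)
  rotate p zero    = p
  rotate p (suc l) = punchIn p l

  module _ {n : ℕ} where

    insert : ∀ {r} → Fin n → (Fin r → Fin n) → Fin (suc r) → Fin n
    insert {zero}  v T = v ∷ T
    insert {suc r} v T with v Finₚ.<? T zero
    ... | yes _ = v ∷ T
    ... | no  _ = T zero ∷ insert v (tail T)

    insertIndex : ∀ {r} → Fin n → (Fin r → Fin n) → Fin (suc r)
    insertIndex {zero}  v T = zero
    insertIndex {suc r} v T with v Finₚ.<? T zero
    ... | yes _ = zero
    ... | no  _ = suc (insertIndex v (tail T))

    insert-rotate : ∀ {r} v (T : Fin r → Fin n) l →
                    (v ∷ T) l ≡ insert v T (rotate (insertIndex v T) l)
    insert-rotate {zero}  v T zero = refl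
    insert-rotate {suc r} v T l with v Finₚ.<? T zero
    insert-rotate {suc r} v T zero          | yes _ = refl
    insert-rotate {suc r} v T (suc l)       | yes _ = refl
    insert-rotate {suc r} v T zero          | no  _ = insert-rotate v (tail T) zero
    insert-rotate {suc r} v T (suc zero)    | no  _ = refl
    insert-rotate {suc r} v T (suc (suc l)) | no  _ = insert-rotate v (tail T) (suc l)

    insert-values : ∀ {r} v (T : Fin r → Fin n) l → insert v T l ≡ v ⊎ insert v T l ∈ᵛ T
    insert-values {zero}  v T zero = inj₁ refl
    insert-values {suc r} v T l with v Finₚ.<? T zero
    insert-values {suc r} v T zero    | yes _ = inj₁ refl
    insert-values {suc r} v T (suc l) | yes _ = inj₂ (l , refl)
    insert-values {suc r} v T zero    | no  _ = inj₂ (zero , refl)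
    insert-values {suc r} v T (suc l) | no  _ =
      Sum.map₂ (λ (l′ , e) → suc l′ , e) (insert-values v (tail T) l)

    insert-increasing : ∀ {r} v {T : Fin r → Fin n} →
                        Increasing T → ¬ v ∈ᵛ T → Increasing (insert v T)
    insert-increasing {zero}  v         incT v∉T = increasing₁ _
    insert-increasing {suc r} v {T} incT v∉T with v Finₚ.<? T zero
    ... | yes v<T₀ = ∷-increasing (<head⇒<all incT v<T₀) incT
    ... | no  v≮T₀ = ∷-increasing T₀<insert
          (insert-increasing v (tail-increasing incT) (λ (l , e) → v∉T (suc l , e)))
      where
      T₀<v : T zero Fin.< v
      T₀<v = Finₚ.≤∧≢⇒< (ℕₚ.≮⇒≥ v≮T₀) (λ e → v∉T (zero , e))
      T₀<insert : ∀ l → T zero Fin.< insert v (tail T) l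
      T₀<insert l with insert-values v (tail T) l
      ... | inj₁ e       = ≡.subst (T zero Fin.<_) (≡.sym e) T₀<v
      ... | inj₂ (l′ , e) = ≡.subst (T zero Fin.<_) e (incT zero (suc l′) (s≤s z≤n))

module Subsets where
  open ≡ using (refl)
  open Tuples

  initialSegment : ∀ {k n} → k ≤ n → Inc k n
  initialSegment k≤n = (λ i → Fin.inject≤ i k≤n) , λ i j i<j →
    ≡.subst₂ ℕ._<_ (≡.sym (Finₚ.toℕ-inject≤ i k≤n)) (≡.sym (Finₚ.toℕ-inject≤ j k≤n)) i<j

  increasing⇒∃∉ : ∀ {k n} (S : Fin k → Fin n) (B : Inc (suc k) n) → ∃ λ i → ¬ proj₁ B i ∈ᵛ S
  increasing⇒∃∉ {k} S (B , incB) =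
    Finₚ.¬∀⟶∃¬ (suc k) (λ i → B i ∈ᵛ S) (λ i → B i ∈ᵛ? S) B⊈S
    where
    B⊈S : ¬ (∀ i → B i ∈ᵛ S)
    B⊈S B⊆S with Finₚ.pigeonhole (ℕₚ.n<1+n k) (proj₁ ∘ B⊆S)
    ... | i , j , i<j , same = ℕₚ.<-irrefl (≡.cong toℕ Bi≡Bj) (incB i j i<j)
      where
      Bi≡Bj : B i ≡ B j
      Bi≡Bj = ≡.trans (≡.sym (proj₂ (B⊆S i))) (≡.trans (≡.cong S same) (proj₂ (B⊆S j)))

  binom : ℕ → ℕ → ℕ
  binom n       zero    = 1
  binom zero    (suc r) = 0
  binom (suc n) (suc r) = binom n r ℕ.+ binom n (suc r)

  binom≡C : ∀ n r → binom n r ≡ n C r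
  binom≡C n       zero    = refl
  binom≡C zero    (suc r) = refl
  binom≡C (suc n) (suc r) = ≡.trans (≡.cong₂ ℕ._+_ (binom≡C n r) (binom≡C n (suc r)))
                                    (nCk+nC[k+1]≡[n+1]C[k+1] n r)

  binom-< : ∀ {n r} → n ℕ.< r → binom n r ≡ 0
  binom-< {zero}  {suc r} _         = refl
  binom-< {suc n} {suc r} (s≤s n<r) = ≡.cong₂ ℕ._+_ (binom-< n<r) (binom-< (ℕₚ.m<n⇒m<1+n n<r))

  binom-≤1 : ∀ {n r} → n ≤ r → binom n r ≤ 1
  binom-≤1 {zero}  {zero}  _         = ℕₚ.≤-refl
  binom-≤1 {zero}  {suc r} _         = z≤n
  binom-≤1 {suc n} {suc r} (s≤s n≤r) rewrite binom-< {n} {suc r} (s≤s n≤r) | ℕₚ.+-identityʳ (binom n r) =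
    binom-≤1 n≤r

  shift : ∀ {r n} → Inc r n → Inc r (suc n)
  shift (T , incT) = suc ∘ T , suc-increasing incT

  zero∷shift : ∀ {r n} → Inc r n → Inc (suc r) (suc n)
  zero∷shift (T , incT) = zero ∷ suc ∘ T , ∷-increasing (λ _ → s≤s z≤n) (suc-increasing incT)

  subsets : ∀ n r → Fin (binom n r) → Inc r n
  subsets n       zero    _ = (λ ()) , λ ()
  subsets (suc n) (suc r) a with splitAt (binom n r) a
  ... | inj₁ a′ = zero∷shift (subsets n r a′)
  ... | inj₂ a′ = shift (subsets n (suc r) a′)

  Separates : ∀ {r n} → (Fin r → Fin n) → (Fin r → Fin n) → Fin n → Set
  Separates S T j = (j ∈ᵛ S × ¬ j ∈ᵛ T) ⊎ (¬ j ∈ᵛ S × j ∈ᵛ T)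

  ∈-shift⁺ : ∀ {r n} {j : Fin n} {T : Fin r → Fin n} → j ∈ᵛ T → suc j ∈ᵛ (suc ∘ T)
  ∈-shift⁺ (l , e) = l , ≡.cong suc e

  ∈-shift⁻ : ∀ {r n} {j : Fin n} {T : Fin r → Fin n} → suc j ∈ᵛ (suc ∘ T) → j ∈ᵛ T
  ∈-shift⁻ (l , e) = l , Finₚ.suc-injective e

  ∈-zero∷⁻ : ∀ {r n} {j : Fin n} {T : Fin r → Fin (suc n)} → suc j ∈ᵛ (zero ∷ T) → suc j ∈ᵛ T
  ∈-zero∷⁻ (suc l , e) = l , e

  Separates-shift : ∀ {r n} {S T : Fin r → Fin n} {j} →
                    Separates S T j → Separates (suc ∘ S) (suc ∘ T) (suc j)
  Separates-shift = Sum.map (Prod.map ∈-shift⁺ (_∘ ∈-shift⁻)) (Prod.map (_∘ ∈-shift⁻) ∈-shift⁺)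

  Separates-zero∷ : ∀ {r n} {S T : Fin r → Fin (suc n)} {j} →
                    Separates S T (suc j) → Separates (zero ∷ S) (zero ∷ T) (suc j)
  Separates-zero∷ {j = j} =
    Sum.map (Prod.map (there {P = _≡ suc j}) (_∘ ∈-zero∷⁻)) (Prod.map (_∘ ∈-zero∷⁻) (there {P = _≡ suc j}))

  subsets-separated : ∀ n r {a b} → a ≢ b →
                      ∃ (Separates (proj₁ (subsets n r a)) (proj₁ (subsets n r b)))
  subsets-separated n       zero    {zero} {zero} a≢b = contradiction refl a≢b
  subsets-separated (suc n) (suc r) {a}  {b}    a≢b
    with splitAt (binom n r) a in split-a | splitAt (binom n r) b in split-b
  ... | inj₁ a′ | inj₁ b′ = Prod.map suc (Separates-zero∷ ∘ Separates-shift)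
      (subsets-separated n r λ a′≡b′ → a≢b (≡.trans (≡.sym (Finₚ.splitAt⁻¹-↑ˡ split-a))
        (≡.trans (≡.cong (_↑ˡ binom n (suc r)) a′≡b′) (Finₚ.splitAt⁻¹-↑ˡ split-b))))
  ... | inj₂ a′ | inj₂ b′ = Prod.map suc Separates-shift
      (subsets-separated n (suc r) λ a′≡b′ → a≢b (≡.trans (≡.sym (Finₚ.splitAt⁻¹-↑ʳ split-a))
        (≡.trans (≡.cong (binom n r ↑ʳ_) a′≡b′) (Finₚ.splitAt⁻¹-↑ʳ split-b))))
  ... | inj₁ _ | inj₂ _ = zero , inj₁ ((zero , refl) , λ ())
  ... | inj₂ _ | inj₁ _ = zero , inj₂ ((λ ()) , (zero , refl))

module FinSum {c ℓ} (R : CommutativeRing c ℓ) where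
  open CommutativeRing R hiding (zero)
  open RingDefs R using (sumFin; eval)
  open import Algebra.Properties.Ring ring using (-0#≈0#; -‿+-comm; -‿distribʳ-*)
  open import Relation.Binary.Reasoning.Setoid setoid
  open import Algebra.Solver.Ring.NaturalCoefficients.Default commutativeSemiring

  sumFin-cong : ∀ k {f g : Fin k → Carrier} → (∀ j → f j ≈ g j) → sumFin k f ≈ sumFin k g
  sumFin-cong zero    f≈g = refl
  sumFin-cong (suc k) f≈g = +-cong (f≈g zero) (sumFin-cong k (f≈g ∘ suc))

  sumFin-0 : ∀ k {f : Fin k → Carrier} → (∀ j → f j ≈ 0#) → sumFin k f ≈ 0#
  sumFin-0 zero    f≈0 = refl
  sumFin-0 (suc k) f≈0 = trans (+-cong (f≈0 zero) (sumFin-0 k (f≈0 ∘ suc))) (+-identityʳ 0#)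

  sumFin-+ : ∀ k (f g : Fin k → Carrier) →
             sumFin k (λ j → f j + g j) ≈ sumFin k f + sumFin k g
  sumFin-+ zero    f g = sym (+-identityʳ 0#)
  sumFin-+ (suc k) f g = trans (+-congˡ (sumFin-+ k (f ∘ suc) (g ∘ suc))) (middle-swap _ _ _ _)
    where
    middle-swap : ∀ a b c d → (a + b) + (c + d) ≈ (a + c) + (b + d)
    middle-swap = solve 4 (λ a b c d → (a :+ b) :+ (c :+ d) := (a :+ c) :+ (b :+ d)) refl

  *-distribˡ-sumFin : ∀ k a (f : Fin k → Carrier) → a * sumFin k f ≈ sumFin k (λ j → a * f j)
  *-distribˡ-sumFin zero    a f = zeroʳ a
  *-distribˡ-sumFin (suc k) a f = trans (distribˡ a _ _) (+-congˡ (*-distribˡ-sumFin k a (f ∘ suc)))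

  -‿sumFin : ∀ k (f : Fin k → Carrier) → - sumFin k f ≈ sumFin k (λ j → - f j)
  -‿sumFin zero    f = -0#≈0#
  -‿sumFin (suc k) f = trans (sym (-‿+-comm _ _)) (+-congˡ (-‿sumFin k (f ∘ suc)))

  sumFin-comm : ∀ m n (f : Fin m → Fin n → Carrier) →
                sumFin m (λ i → sumFin n (f i)) ≈ sumFin n (λ j → sumFin m (λ i → f i j))
  sumFin-comm zero    n f = sym (sumFin-0 n (λ _ → refl))
  sumFin-comm (suc m) n f = trans (+-congˡ (sumFin-comm m n (f ∘ suc))) (sym (sumFin-+ n _ _))

  sumFin-*-[x-λy] : ∀ k (a x y : Fin k → Carrier) λ′ →
    sumFin k (λ i → a i * (x i - λ′ * y i)) ≈ sumFin k (λ i → a i * x i) - λ′ * sumFin k (λ i → a i * y i)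
  sumFin-*-[x-λy] k a x y λ′ = begin
    sumFin k (λ i → a i * (x i - λ′ * y i))               ≈⟨ sumFin-cong k pointwise ⟩
    sumFin k (λ i → a i * x i + - (λ′ * (a i * y i)))     ≈⟨ sumFin-+ k _ _ ⟩
    sumFin k (λ i → a i * x i) + sumFin k (λ i → - (λ′ * (a i * y i)))
                                                          ≈⟨ +-congˡ (-‿sumFin k _) ⟨
    sumFin k (λ i → a i * x i) + - sumFin k (λ i → λ′ * (a i * y i))
                                                          ≈⟨ +-congˡ (-‿cong (*-distribˡ-sumFin k λ′ _)) ⟨
    sumFin k (λ i → a i * x i) - λ′ * sumFin k (λ i → a i * y i) ∎
    where
    pointwise : ∀ i → a i * (x i - λ′ * y i) ≈ a i * x i + - (λ′ * (a i * y i))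
    pointwise i = trans (distribˡ (a i) (x i) _) (+-congˡ (trans (sym (-‿distribʳ-* (a i) _))
      (-‿cong (solve 3 (λ a λ′ y → a :* (λ′ :* y) := λ′ :* (a :* y)) refl (a i) λ′ (y i)))))

  sumExpr : ∀ {V} k → (Fin k → Expr Carrier V) → Expr Carrier V
  sumExpr zero    e = con 0#
  sumExpr (suc k) e = e zero ⊕ sumExpr k (e ∘ suc)

  eval-sumExpr : ∀ {V} (ρ : V → Carrier) k (e : Fin k → Expr Carrier V) →
                 eval ρ (sumExpr k e) ≡ sumFin k (eval ρ ∘ e)
  eval-sumExpr ρ zero    e = ≡.refl
  eval-sumExpr ρ (suc k) e = ≡.cong (eval ρ (e zero) +_) (eval-sumExpr ρ k (e ∘ suc))

module Sign {c ℓ} (R : CommutativeRing c ℓ) where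
  open CommutativeRing R hiding (zero)
  open RingDefs R using (sign)
  open import Algebra.Properties.Ring ring using (-‿distribˡ-*; -‿distribʳ-*; -‿involutive)
  open import Relation.Binary.Reasoning.Setoid setoid

  sign-suc-comm : ∀ a b → sign (suc a) * sign b ≈ sign (suc b) * sign a
  sign-suc-comm a b = begin
    - sign a * sign b    ≈⟨ -‿distribˡ-* (sign a) (sign b) ⟨
    - (sign a * sign b)  ≈⟨ -‿cong (*-comm (sign a) (sign b)) ⟩
    - (sign b * sign a)  ≈⟨ -‿distribˡ-* (sign b) (sign a) ⟩
    - sign b * sign a    ∎

  sign²≈1 : ∀ n → sign n * sign n ≈ 1#
  sign²≈1 zero    = *-identityˡ 1#
  sign²≈1 (suc n) = begin
    - sign n * - sign n      ≈⟨ -‿distribˡ-* (sign n) (- sign n) ⟨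
    - (sign n * - sign n)    ≈⟨ -‿cong (-‿distribʳ-* (sign n) (sign n)) ⟨
    - - (sign n * sign n)    ≈⟨ -‿involutive _ ⟩
    sign n * sign n          ≈⟨ sign²≈1 n ⟩
    1#                       ∎

module Determinant {c ℓ} (R : CommutativeRing c ℓ) where
  open CommutativeRing R hiding (zero)
  open RingDefs R using (sumFin; sign; det)
  open FinSum R
  open Sign R
  open import Algebra.Solver.Ring.NaturalCoefficients.Default commutativeSemiring
  open Tuples using (rotate; _∈ᵛ_)
  open import Algebra.Properties.Ring ring
  open import Relation.Binary.Reasoning.Setoid setoid

  Matrix : ℕ → ℕ → Set c
  Matrix m n = Fin m → Fin n → Carrier

  _ᵀ : ∀ {m n} → Matrix m n → Matrix n m
  (M ᵀ) i j = M j i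

  _∘ᶜ_ : ∀ {m n k} → Matrix m n → (Fin k → Fin n) → Matrix m k
  (M ∘ᶜ s) i l = M i (s l)

  det-cong : ∀ k {M N : Matrix k k} → (∀ i j → M i j ≈ N i j) → det k M ≈ det k N
  det-cong zero    M≈N = refl
  det-cong (suc k) M≈N = sumFin-cong (suc k) λ j →
    *-congˡ {sign (toℕ j)} (*-cong (M≈N zero j) (det-cong k (λ i l → M≈N (suc i) (punchIn j l))))

  -- det expands along the first row; expansion along the first column and invariance under
  -- transposition are proved together, by induction through the double expansion of size k+2.
  TransposeInvariant : ℕ → Set _
  TransposeInvariant k = ∀ (M : Matrix k k) → det k (M ᵀ) ≈ det k M

  expansionCol₀ : ∀ k → Matrix (suc k) (suc k) → Carrier
  expansionCol₀ k N =
    sumFin (suc k) (λ i → sign (toℕ i) * (N i zero * det k (λ a b → N (punchIn i a) (suc b))))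

  expandCol₀′ : ∀ {k} → TransposeInvariant (suc k) → TransposeInvariant k →
                ∀ N → det (suc k) N ≈ expansionCol₀ k N
  expandCol₀′ {k} inv₁ inv₀ N =
    trans (sym (inv₁ N)) (sumFin-cong (suc k) λ i →
      *-congˡ {sign (toℕ i)} (*-congˡ {N i zero} (inv₀ (λ a b → N (punchIn i a) (suc b)))))

  doubleExpansion : ∀ k → Matrix (suc (suc k)) (suc (suc k)) → Carrier
  doubleExpansion k M =
    M zero zero * det (suc k) (λ i l → M (suc i) (suc l)) +
    sumFin (suc k) (λ j → sumFin (suc k) (λ i → (sign (toℕ (suc j)) * sign (toℕ i)) *
      (M zero (suc j) * (M (suc i) zero * det k (λ a b → M (suc (punchIn i a)) (suc (punchIn j b)))))))

  expand₂ : ∀ {k} → TransposeInvariant (suc k) → TransposeInvariant k →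
            ∀ M → det (suc (suc k)) M ≈ doubleExpansion k M
  expand₂ {k} inv₁ inv₀ M = +-cong (*-identityˡ _) (sumFin-cong (suc k) expandMinor)
    where
    expandMinor : ∀ j →
      sign (toℕ (suc j)) * (M zero (suc j) * det (suc k) (λ i l → M (suc i) (punchIn (suc j) l))) ≈
      sumFin (suc k) (λ i → (sign (toℕ (suc j)) * sign (toℕ i)) *
        (M zero (suc j) * (M (suc i) zero * det k (λ a b → M (suc (punchIn i a)) (suc (punchIn j b))))))
    expandMinor j = begin
      s * (x * det (suc k) N)                  ≈⟨ *-congˡ (*-congˡ (expandCol₀′ inv₁ inv₀ N)) ⟩
      s * (x * expansionCol₀ k N)              ≈⟨ *-congˡ (*-distribˡ-sumFin (suc k) x g) ⟩
      s * sumFin (suc k) (λ i → x * g i)       ≈⟨ *-distribˡ-sumFin (suc k) s (λ i → x * g i) ⟩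
      sumFin (suc k) (λ i → s * (x * g i))     ≈⟨ sumFin-cong (suc k) (λ i → regroup s x (sign (toℕ i)) (N i zero) (d i)) ⟩
      _ ∎
      where
      s x : Carrier
      s = sign (toℕ (suc j))
      x = M zero (suc j)
      N : Matrix (suc k) (suc k)
      N i l = M (suc i) (punchIn (suc j) l)
      d : Fin (suc k) → Carrier
      d i = det k (λ a b → N (punchIn i a) (suc b))
      g : Fin (suc k) → Carrier
      g i = sign (toℕ i) * (N i zero * d i)
      regroup : ∀ s x t y d → s * (x * (t * (y * d))) ≈ (s * t) * (x * (y * d))
      regroup = solve 5 (λ s x t y d → s :* (x :* (t :* (y :* d))) := (s :* t) :* (x :* (y :* d))) refl

  det-ᵀ : ∀ k → TransposeInvariant k
  det-ᵀ zero          M = refl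
  det-ᵀ (suc zero)    M = refl
  det-ᵀ (suc (suc k)) M = begin
    det (suc (suc k)) (M ᵀ)   ≈⟨ expand₂ (det-ᵀ (suc k)) (det-ᵀ k) (M ᵀ) ⟩
    doubleExpansion k (M ᵀ)   ≈⟨ +-cong (*-congˡ (det-ᵀ (suc k) (λ i l → M (suc i) (suc l)))) (sumFin-comm (suc k) (suc k) F) ⟩
    _                         ≈⟨ +-congˡ (sumFin-cong (suc k) λ i → sumFin-cong (suc k) λ j →
                                   *-cong (sign-suc-comm (toℕ j) (toℕ i)) (swapFactors i j)) ⟩
    doubleExpansion k M       ≈⟨ sym (expand₂ (det-ᵀ (suc k)) (det-ᵀ k) M) ⟩
    det (suc (suc k)) M       ∎
    where
    F : Fin (suc k) → Fin (suc k) → Carrier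
    F j i = (sign (toℕ (suc j)) * sign (toℕ i)) *
      (M (suc j) zero * (M zero (suc i) * det k (λ a b → M (suc (punchIn j b)) (suc (punchIn i a)))))
    swapFactors : ∀ i j →
      M (suc j) zero * (M zero (suc i) * det k (λ a b → M (suc (punchIn j b)) (suc (punchIn i a)))) ≈
      M zero (suc i) * (M (suc j) zero * det k (λ a b → M (suc (punchIn j a)) (suc (punchIn i b))))
    swapFactors i j = trans (*-congˡ (*-congˡ (det-ᵀ k (λ a b → M (suc (punchIn j a)) (suc (punchIn i b))))))
      (solve 3 (λ x y d → x :* (y :* d) := y :* (x :* d)) refl _ _ _)

  expandCol₀ : ∀ k N → det (suc k) N ≈ expansionCol₀ k N
  expandCol₀ k = expandCol₀′ (det-ᵀ (suc k)) (det-ᵀ k)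

  swap₀₁ : ∀ {k} → Fin (suc (suc k)) → Fin (suc (suc k))
  swap₀₁ zero          = suc zero
  swap₀₁ (suc zero)    = zero
  swap₀₁ (suc (suc l)) = suc (suc l)

  lift₀ : ∀ {k} → (Fin k → Fin k) → Fin (suc k) → Fin (suc k)
  lift₀ π zero    = zero
  lift₀ π (suc l) = suc (π l)

  expansionFrom₂ : ∀ k → Matrix (suc (suc k)) (suc (suc k)) → Carrier
  expansionFrom₂ k M = sumFin k (λ j → sign (toℕ (suc (suc j))) *
    (M zero (suc (suc j)) * det (suc k) (λ i l → M (suc i) (punchIn (suc (suc j)) l))))

  -‿distrib-+₃ : ∀ a b r → - (a + (b + r)) ≈ - b + (- a + - r)
  -‿distrib-+₃ a b r = begin
    - (a + (b + r))       ≈⟨ -‿+-comm a (b + r) ⟨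
    - a + - (b + r)       ≈⟨ +-congˡ (-‿+-comm b r) ⟨
    - a + (- b + - r)     ≈⟨ solve 3 (λ x y z → x :+ (y :+ z) := y :+ (x :+ z)) refl (- a) (- b) (- r) ⟩
    - b + (- a + - r)     ∎

  det-swap₀₁ : ∀ k (M : Matrix (suc (suc k)) (suc (suc k))) →
               det (suc (suc k)) (M ∘ᶜ swap₀₁) ≈ - det (suc (suc k)) M
  det-swap₀₁ k M = trans (+-cong first (+-cong second (later k M))) (sym (-‿distrib-+₃ _ _ _))
    where
    swapped₀ : ∀ i l → M (suc i) (swap₀₁ (punchIn zero l)) ≈ M (suc i) (punchIn (suc zero) l)
    swapped₀ i zero    = refl
    swapped₀ i (suc l) = refl
    swapped₁ : ∀ i l → M (suc i) (swap₀₁ (punchIn (suc zero) l)) ≈ M (suc i) (punchIn zero l)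
    swapped₁ i zero    = refl
    swapped₁ i (suc l) = refl
    first : sign 0 * (M zero (suc zero) * det (suc k) (λ i l → M (suc i) (swap₀₁ (punchIn zero l)))) ≈
            - (sign 1 * (M zero (suc zero) * det (suc k) (λ i l → M (suc i) (punchIn (suc zero) l))))
    first = trans (*-congˡ (*-congˡ (det-cong (suc k) swapped₀)))
      (trans (sym (-‿involutive _)) (-‿cong (-‿distribˡ-* _ _)))
    second : sign 1 * (M zero zero * det (suc k) (λ i l → M (suc i) (swap₀₁ (punchIn (suc zero) l)))) ≈
             - (sign 0 * (M zero zero * det (suc k) (λ i l → M (suc i) (punchIn zero l))))
    second = trans (*-congˡ (*-congˡ (det-cong (suc k) swapped₁))) (sym (-‿distribˡ-* _ _))
    later : ∀ k (M : Matrix (suc (suc k)) (suc (suc k))) →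
            expansionFrom₂ k (M ∘ᶜ swap₀₁) ≈ - expansionFrom₂ k M
    later zero    M = sym -0#≈0#
    later (suc k) M = begin
      expansionFrom₂ (suc k) (M ∘ᶜ swap₀₁)          ≈⟨ sumFin-cong (suc k) (λ j → *-congˡ {s j} (*-congˡ {x j}
                                                       (trans (det-cong (suc (suc k)) (swappedMinor j))
                                                              (det-swap₀₁ k (minor j))))) ⟩
      sumFin (suc k) (λ j → s j * (x j * - d j))    ≈⟨ sumFin-cong (suc k) (λ j → trans
                                                       (*-congˡ (sym (-‿distribʳ-* (x j) (d j))))
                                                       (sym (-‿distribʳ-* (s j) (x j * d j)))) ⟩
      sumFin (suc k) (λ j → - (s j * (x j * d j)))  ≈⟨ -‿sumFin (suc k) (λ j → s j * (x j * d j)) ⟨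
      - expansionFrom₂ (suc k) M                    ∎
      where
      s x : Fin (suc k) → Carrier
      s j = sign (toℕ (suc (suc j)))
      x j = M zero (suc (suc j))
      minor : Fin (suc k) → Matrix (suc (suc k)) (suc (suc k))
      minor j i l = M (suc i) (punchIn (suc (suc j)) l)
      d : Fin (suc k) → Carrier
      d j = det (suc (suc k)) (minor j)
      swappedMinor : ∀ j i l → M (suc i) (swap₀₁ (punchIn (suc (suc j)) l)) ≈ (minor j ∘ᶜ swap₀₁) i l
      swappedMinor j i zero          = refl
      swappedMinor j i (suc zero)    = refl
      swappedMinor j i (suc (suc l)) = refl

  det-col₀≈col₁ : ∀ k (M : Matrix (suc (suc k)) (suc (suc k))) →
                  (∀ i → M i zero ≈ M i (suc zero)) → det (suc (suc k)) M ≈ 0#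
  det-col₀≈col₁ k M M₀≈M₁ = begin
    det (suc (suc k)) M                    ≈⟨ +-cong (*-congˡ (*-cong (M₀≈M₁ zero) (det-cong (suc k) minors≈)))
                                                     (+-cong (sym (-‿distribˡ-* _ _)) (later k M M₀≈M₁)) ⟩
    t + (- t + 0#)                         ≈⟨ +-congˡ (+-identityʳ (- t)) ⟩
    t + - t                                ≈⟨ -‿inverseʳ t ⟩
    0#                                     ∎
    where
    t : Carrier
    t = sign 0 * (M zero (suc zero) * det (suc k) (λ i l → M (suc i) (punchIn (suc zero) l)))
    minors≈ : ∀ i l → M (suc i) (punchIn zero l) ≈ M (suc i) (punchIn (suc zero) l)
    minors≈ i zero    = sym (M₀≈M₁ (suc i))
    minors≈ i (suc l) = refl
    later : ∀ k (M : Matrix (suc (suc k)) (suc (suc k))) → (∀ i → M i zero ≈ M i (suc zero)) →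
            expansionFrom₂ k M ≈ 0#
    later zero    M M₀≈M₁ = refl
    later (suc k) M M₀≈M₁ = sumFin-0 (suc k) λ j →
      trans (*-congˡ {sign (toℕ (suc (suc j)))} (*-congˡ {M zero (suc (suc j))}
              (det-col₀≈col₁ k (λ i l → M (suc i) (punchIn (suc (suc j)) l)) (M₀≈M₁ ∘ suc))))
            (trans (*-congˡ (zeroʳ _)) (zeroʳ _))

  det-lift₀ : ∀ k (π : Fin k → Fin k) ε → (∀ N → det k (N ∘ᶜ π) ≈ ε * det k N) →
              ∀ M → det (suc k) (M ∘ᶜ lift₀ π) ≈ ε * det (suc k) M
  det-lift₀ k π ε det-π M = begin
    det (suc k) (M ∘ᶜ lift₀ π)             ≈⟨ expandCol₀ k (M ∘ᶜ lift₀ π) ⟩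
    expansionCol₀ k (M ∘ᶜ lift₀ π)         ≈⟨ sumFin-cong (suc k) (λ i → trans
                                                (*-congˡ {sign (toℕ i)} (*-congˡ {M i zero} (det-π (minor i))))
                                                (pullOut (sign (toℕ i)) (M i zero) (det k (minor i)) ε)) ⟩
    sumFin (suc k) (λ i → ε * term i)     ≈⟨ *-distribˡ-sumFin (suc k) ε term ⟨
    ε * expansionCol₀ k M                  ≈⟨ *-congˡ (expandCol₀ k M) ⟨
    ε * det (suc k) M                      ∎
    where
    minor : Fin (suc k) → Matrix k k
    minor i a b = M (punchIn i a) (suc b)
    term : Fin (suc k) → Carrier
    term i = sign (toℕ i) * (M i zero * det k (minor i))
    pullOut : ∀ s m d e → s * (m * (e * d)) ≈ e * (s * (m * d))
    pullOut = solve 4 (λ s m d e → s :* (m :* (e :* d)) := e :* (s :* (m :* d))) refl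

  det-rotate : ∀ k (p : Fin (suc k)) (M : Matrix (suc k) (suc k)) →
               det (suc k) (M ∘ᶜ rotate p) ≈ sign (toℕ p) * det (suc k) M
  det-rotate k       zero    M = trans (det-cong (suc k) rotate₀) (sym (*-identityˡ _))
    where
    rotate₀ : ∀ i l → M i (rotate zero l) ≈ M i l
    rotate₀ i zero    = refl
    rotate₀ i (suc l) = refl
  det-rotate (suc k) (suc p) M = begin
    det (suc (suc k)) (M ∘ᶜ rotate (suc p))              ≈⟨ det-cong (suc (suc k)) rotate≗lift∘swap ⟩
    det (suc (suc k)) ((M ∘ᶜ lift₀ (rotate p)) ∘ᶜ swap₀₁) ≈⟨ det-swap₀₁ k (M ∘ᶜ lift₀ (rotate p)) ⟩
    - det (suc (suc k)) (M ∘ᶜ lift₀ (rotate p))          ≈⟨ -‿cong (det-lift₀ (suc k) (rotate p) _ (det-rotate k p) M) ⟩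
    - (sign (toℕ p) * det (suc (suc k)) M)               ≈⟨ -‿distribˡ-* _ _ ⟩
    sign (toℕ (suc p)) * det (suc (suc k)) M             ∎
    where
    rotate≗lift∘swap : ∀ i l → M i (rotate (suc p) l) ≈ M i (lift₀ (rotate p) (swap₀₁ l))
    rotate≗lift∘swap i zero          = refl
    rotate≗lift∘swap i (suc zero)    = refl
    rotate≗lift∘swap i (suc (suc l)) = refl

  det-col₀≈col : ∀ k (M : Matrix (suc (suc k)) (suc (suc k))) (l : Fin (suc k)) →
                 (∀ i → M i zero ≈ M i (suc l)) → det (suc (suc k)) M ≈ 0#
  det-col₀≈col k M l M₀≈Mₗ = begin
    det (suc (suc k)) M                          ≈⟨ *-identityˡ _ ⟨
    1# * det (suc (suc k)) M                     ≈⟨ *-congʳ (sign²≈1 (toℕ l)) ⟨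
    (s * s) * det (suc (suc k)) M                ≈⟨ *-assoc s s _ ⟩
    s * (s * det (suc (suc k)) M)                ≈⟨ *-congˡ (det-lift₀ (suc k) (rotate l) s (det-rotate k l) M) ⟨
    s * det (suc (suc k)) (M ∘ᶜ lift₀ (rotate l)) ≈⟨ *-congˡ (det-col₀≈col₁ k (M ∘ᶜ lift₀ (rotate l)) M₀≈Mₗ) ⟩
    s * 0#                                       ≈⟨ zeroʳ s ⟩
    0#                                           ∎
    where
    s : Carrier
    s = sign (toℕ l)

  det-row₀≈row : ∀ k (M : Matrix (suc (suc k)) (suc (suc k))) (r : Fin (suc k)) →
                 (∀ l → M zero l ≈ M (suc r) l) → det (suc (suc k)) M ≈ 0#
  det-row₀≈row k M r M₀≈Mᵣ = trans (sym (det-ᵀ (suc (suc k)) M)) (det-col₀≈col k (M ᵀ) r M₀≈Mᵣ)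

  det-∷∈ : ∀ {k n} (X : Matrix (suc k) n) v (T : Fin k → Fin n) → v ∈ᵛ T →
           det (suc k) (X ∘ᶜ (v ∷ T)) ≈ 0#
  det-∷∈ {zero}  X v T (() , _)
  det-∷∈ {suc k} X v T (l , Tl≡v) =
    det-col₀≈col k (X ∘ᶜ (v ∷ T)) l (λ i → reflexive (≡.cong (X i) (≡.sym Tl≡v)))

  -- Expanding det (X ∘ᶜ (W c ∷ S)) along its first column, the coefficient of the l-th cofactor
  -- is the first-row expansion of (X l ∷ X) ∘ᶜ W, a matrix with two equal rows.
  det-plücker : ∀ {k n} (X : Matrix (suc k) n) (W : Fin (suc (suc k)) → Fin n) (S : Fin k → Fin n) →
    sumFin (suc (suc k)) (λ c → (sign (toℕ c) * det (suc k) (X ∘ᶜ (W ∘ punchIn c))) *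
                                det (suc k) (X ∘ᶜ (W c ∷ S))) ≈ 0#
  det-plücker {k} X W S = begin
    sumFin (suc (suc k)) (λ c → a c * det (suc k) (X ∘ᶜ (W c ∷ S)))
      ≈⟨ sumFin-cong (suc (suc k)) (λ c → *-congˡ {a c} (sym (det-ᵀ (suc k) (X ∘ᶜ (W c ∷ S))))) ⟩
    sumFin (suc (suc k)) (λ c → a c * sumFin (suc k) (f c))
      ≈⟨ sumFin-cong (suc (suc k)) (λ c → *-distribˡ-sumFin (suc k) (a c) (f c)) ⟩
    sumFin (suc (suc k)) (λ c → sumFin (suc k) (λ l → a c * f c l))
      ≈⟨ sumFin-comm (suc (suc k)) (suc k) (λ c l → a c * f c l) ⟩
    sumFin (suc k) (λ l → sumFin (suc (suc k)) (λ c → a c * f c l))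
      ≈⟨ sumFin-0 (suc k) vanishes ⟩
    0# ∎
    where
    a : Fin (suc (suc k)) → Carrier
    a c = sign (toℕ c) * det (suc k) (X ∘ᶜ (W ∘ punchIn c))
    D : Fin (suc k) → Carrier
    D l = det k (λ i j → X (punchIn l j) (S i))
    f : Fin (suc (suc k)) → Fin (suc k) → Carrier
    f c l = sign (toℕ l) * (X l (W c) * D l)
    rowExpansion≈0 : ∀ l → sumFin (suc (suc k)) (λ c → a c * X l (W c)) ≈ 0#
    rowExpansion≈0 l = trans
      (sumFin-cong (suc (suc k)) (λ c → solve 3 (λ s d x → (s :* d) :* x := s :* (x :* d)) refl
                                              (sign (toℕ c)) (det (suc k) (X ∘ᶜ (W ∘ punchIn c))) (X l (W c))))
      (det-row₀≈row k ((X l ∷ X) ∘ᶜ W) l (λ _ → refl))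
    vanishes : ∀ l → sumFin (suc (suc k)) (λ c → a c * f c l) ≈ 0#
    vanishes l = begin
      sumFin (suc (suc k)) (λ c → a c * f c l)
        ≈⟨ sumFin-cong (suc (suc k)) (λ c → solve 4 (λ a s x d → a :* (s :* (x :* d)) := (s :* d) :* (a :* x))
                                                   refl (a c) (sign (toℕ l)) (X l (W c)) (D l)) ⟩
      sumFin (suc (suc k)) (λ c → (sign (toℕ l) * D l) * (a c * X l (W c)))
        ≈⟨ *-distribˡ-sumFin (suc (suc k)) (sign (toℕ l) * D l) (λ c → a c * X l (W c)) ⟨
      (sign (toℕ l) * D l) * sumFin (suc (suc k)) (λ c → a c * X l (W c))
        ≈⟨ *-congˡ (rowExpansion≈0 l) ⟩
      (sign (toℕ l) * D l) * 0#
        ≈⟨ zeroʳ _ ⟩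
      0# ∎

module PlückerCoordinates {c ℓ} (A : CommutativeRing c ℓ) {k n : ℕ} where
  open CommutativeRing A hiding (zero)
  open RingDefs A
  open FinSum A
  open Determinant A using (Matrix; _∘ᶜ_; det-cong; det-rotate; det-∷∈; det-plücker)
  open Tuples
  open import Algebra.Solver.Ring.NaturalCoefficients.Default commutativeSemiring

  -- coord ρ (v , T) is the coordinate of the column sequence v ∷ T: zero if v occurs in T,
  -- and otherwise (−1)ⁱ ρ(T ∪ {v}), where i is the position of v in the sorted tuple.
  coordExpr : Fin n × Inc k n → Expr Carrier (Inc (suc k) n)
  coordExpr (v , T , incT) with v ∈ᵛ? T
  ... | yes _   = con 0#
  ... | no  v∉T = con (sign (toℕ (insertIndex v T))) ⊗ var (insert v T , insert-increasing v incT v∉T)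

  coord : (Inc (suc k) n → Carrier) → Fin n × Inc k n → Carrier
  coord ρ x = eval ρ (coordExpr x)

  coord-∈ : ∀ ρ {v} (S : Inc k n) → v ∈ᵛ proj₁ S → coord ρ (v , S) ≈ 0#
  coord-∈ ρ {v} (T , incT) v∈T with v ∈ᵛ? T
  ... | yes _   = refl
  ... | no  v∉T = contradiction v∈T v∉T

  coord-minor : ∀ (X : Matrix (suc k) n) v (S : Inc k n) →
                coord (minor X) (v , S) ≈ det (suc k) (X ∘ᶜ (v ∷ proj₁ S))
  coord-minor X v (T , incT) with v ∈ᵛ? T
  coord-minor X v (T , incT) | no  v∉T = sym (trans
    (det-cong (suc k) (λ i l → reflexive (≡.cong (X i) (insert-rotate v T l))))
    (det-rotate k (insertIndex v T) (X ∘ᶜ insert v T)))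
  coord-minor X v (T , incT) | yes v∈T = sym (det-∷∈ X v T v∈T)

  -- dropAt B j c is j ∷ B with its c-th entry deleted, split into head and increasing tail;
  -- plückerRel ρ B j S is the Plücker relation Σ_c (−1)ᶜ ρ(W ∖ W_c) ρ(S ∪ {W_c}) for W = j ∷ B.
  dropAt : Inc (suc k) n → Fin n → Fin (suc (suc k)) → Fin n × Inc k n
  dropAt (B , incB) j zero    = B zero , tail B , tail-increasing incB
  dropAt (B , incB) j (suc i) = j , B ∘ punchIn i , λ a b a<b → incB _ _ (punchIn-increasing i a b a<b)

  dropAt-∷ : ∀ B j c l → (proj₁ (dropAt B j c) ∷ proj₁ (proj₂ (dropAt B j c))) l ≡ (j ∷ proj₁ B) (punchIn c l)
  dropAt-∷ B j zero    zero    = ≡.refl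
  dropAt-∷ B j zero    (suc l) = ≡.refl
  dropAt-∷ B j (suc i) zero    = ≡.refl
  dropAt-∷ B j (suc i) (suc l) = ≡.refl

  plückerTerm : (Inc (suc k) n → Carrier) → Inc (suc k) n → Fin n → Inc k n → Fin (suc (suc k)) → Carrier
  plückerTerm ρ B j S c = sign (toℕ c) * (coord ρ (dropAt B j c) * coord ρ ((j ∷ proj₁ B) c , S))

  plückerRel : (Inc (suc k) n → Carrier) → Inc (suc k) n → Fin n → Inc k n → Carrier
  plückerRel ρ B j S = sumFin (suc (suc k)) (plückerTerm ρ B j S)

  plückerTermExpr : Inc (suc k) n → Fin n → Inc k n → Fin (suc (suc k)) → Expr Carrier (Inc (suc k) n)
  plückerTermExpr B j S c = con (sign (toℕ c)) ⊗ (coordExpr (dropAt B j c) ⊗ coordExpr ((j ∷ proj₁ B) c , S))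

  plückerExpr : Inc (suc k) n → Fin n → Inc k n → Expr Carrier (Inc (suc k) n)
  plückerExpr B j S = sumExpr (suc (suc k)) (plückerTermExpr B j S)

  eval-plückerExpr : ∀ ρ B j S → eval ρ (plückerExpr B j S) ≡ plückerRel ρ B j S
  eval-plückerExpr ρ B j S = eval-sumExpr ρ (suc (suc k)) (plückerTermExpr B j S)

  plückerRel-minor : ∀ (X : Matrix (suc k) n) B j S → plückerRel (minor X) B j S ≈ 0#
  plückerRel-minor X B j S = trans (sumFin-cong (suc (suc k)) term≈) (det-plücker X (j ∷ proj₁ B) (proj₁ S))
    where
    W : Fin (suc (suc k)) → Fin n
    W = j ∷ proj₁ B
    term≈ : ∀ c → plückerTerm (minor X) B j S c ≈
                  (sign (toℕ c) * det (suc k) (X ∘ᶜ (W ∘ punchIn c))) * det (suc k) (X ∘ᶜ (W c ∷ proj₁ S))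
    term≈ c = trans (*-congˡ (*-cong
        (trans (coord-minor X _ _) (det-cong (suc k) (λ i l → reflexive (≡.cong (X i) (dropAt-∷ B j c l)))))
        (coord-minor X (W c) S)))
      (sym (*-assoc _ _ _))

  coord-scale : ∀ {ρ σ : Inc (suc k) n → Carrier} a → (∀ I → ρ I ≈ a * σ I) →
                ∀ x → coord ρ x ≈ a * coord σ x
  coord-scale a ρ≈aσ (v , T , incT) with v ∈ᵛ? T
  ... | yes _ = sym (zeroʳ a)
  ... | no  _ = trans (*-congˡ (ρ≈aσ _)) (solve 3 (λ s a y → s :* (a :* y) := a :* (s :* y)) refl _ _ _)

  plückerRel-scale : ∀ {ρ σ : Inc (suc k) n → Carrier} a → (∀ I → ρ I ≈ a * σ I) →
                     ∀ B j S → plückerRel ρ B j S ≈ (a * a) * plückerRel σ B j S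
  plückerRel-scale {ρ} {σ} a ρ≈aσ B j S = begin
    plückerRel ρ B j S                         ≈⟨ sumFin-cong (suc (suc k)) term≈ ⟩
    sumFin (suc (suc k)) (λ c → (a * a) * plückerTerm σ B j S c)
                                               ≈⟨ *-distribˡ-sumFin (suc (suc k)) (a * a) (plückerTerm σ B j S) ⟨
    (a * a) * plückerRel σ B j S               ∎
    where
    open import Relation.Binary.Reasoning.Setoid setoid
    term≈ : ∀ c → plückerTerm ρ B j S c ≈ (a * a) * plückerTerm σ B j S c
    term≈ c = trans (*-congˡ (*-cong (coord-scale a ρ≈aσ _) (coord-scale a ρ≈aσ _)))
      (solve 4 (λ s a x y → s :* ((a :* x) :* (a :* y)) := (a :* a) :* (s :* (x :* y))) refl _ _ _ _)

module Arithmetic {c ℓ} (R : CommutativeRing c ℓ) where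
  open CommutativeRing R hiding (zero)
  open RingDefs R
  open import Algebra.Properties.Ring ring using (-‿distribˡ-*; -‿involutive)

  ∣-resp-≈ : ∀ {d a b} → a ≈ b → d ∣ a → d ∣ b
  ∣-resp-≈ a≈b (e , a≈ed) = e , trans (sym a≈b) a≈ed

  ∣-+ : ∀ {d a b} → d ∣ a → d ∣ b → d ∣ (a + b)
  ∣-+ {d} (e , a≈ed) (e′ , b≈e′d) = e + e′ , trans (+-cong a≈ed b≈e′d) (sym (distribʳ d e e′))

  ∣-*ˡ : ∀ a {d b} → d ∣ b → d ∣ (a * b)
  ∣-*ˡ a (e , b≈ed) = a * e , trans (*-congˡ b≈ed) (sym (*-assoc a e _))

  ∣-neg : ∀ {d a} → d ∣ a → d ∣ (- a)
  ∣-neg {d} (e , a≈ed) = - e , trans (-‿cong a≈ed) (-‿distribˡ-* e d)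

  ∣-neg⁻¹ : ∀ {d a} → d ∣ (- a) → d ∣ a
  ∣-neg⁻¹ d∣-a = ∣-resp-≈ (-‿involutive _) (∣-neg d∣-a)

  ∣-sumFin : ∀ {d} k (f : Fin k → Carrier) → (∀ i → d ∣ f i) → d ∣ sumFin k f
  ∣-sumFin zero    f d∣f = 0# , sym (zeroˡ _)
  ∣-sumFin (suc k) f d∣f = ∣-+ (d∣f zero) (∣-sumFin k (f ∘ suc) (d∣f ∘ suc))

  ∣-sign⁻¹ : ∀ {d} m {x} → d ∣ (sign m * x) → d ∣ x
  ∣-sign⁻¹ m {x} d∣sx = ∣-resp-≈ sign∙sign∙x≈x (∣-*ˡ (sign m) d∣sx)
    where
    open Sign R using (sign²≈1)
    sign∙sign∙x≈x : sign m * (sign m * x) ≈ x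
    sign∙sign∙x≈x = trans (sym (*-assoc _ _ _)) (trans (*-congʳ (sign²≈1 m)) (*-identityˡ x))

  module _ {q} (q-prime : IsPrime q) where
    open IsPrime q-prime

    prime∤1 : ¬ q ∣ 1#
    prime∤1 (e , 1≈eq) = nonunit (e , trans (*-comm q e) (sym 1≈eq))

    prime∤* : ∀ {a b} → ¬ q ∣ a → ¬ q ∣ b → ¬ q ∣ (a * b)
    prime∤* q∤a q∤b q∣ab = Sum.[ q∤a , q∤b ] (divides _ _ q∣ab)

    valuation-factor : ∀ {a m} → ValEq q a m → ∃ λ a′ → a ≈ pow q m * a′ × ¬ q ∣ a′
    valuation-factor {a} {m} ((a′ , a≈a′qᵐ) , maximal) = a′ , trans a≈a′qᵐ (*-comm a′ _) , q∤a′
      where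
      q∤a′ : ¬ q ∣ a′
      q∤a′ (e , a′≈eq) = ℕₚ.<-irrefl ≡.refl (maximal (suc m) (e , (begin
        a                  ≈⟨ a≈a′qᵐ ⟩
        a′ * pow q m       ≈⟨ *-congʳ a′≈eq ⟩
        (e * q) * pow q m  ≈⟨ *-assoc e q _ ⟩
        e * pow q (suc m)  ∎)))
        where open import Relation.Binary.Reasoning.Setoid setoid

  module _ (domain : IsIntegralDomain) where
    open IsIntegralDomain domain

    *≉0 : ∀ {a b} → ¬ a ≈ 0# → ¬ b ≈ 0# → ¬ a * b ≈ 0#
    *≉0 a≉0 b≉0 ab≈0 = Sum.[ a≉0 , b≉0 ] (noZeroDiv _ _ ab≈0)

    pow≉0 : ∀ {q} → ¬ q ≈ 0# → ∀ m → ¬ pow q m ≈ 0#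
    pow≉0 q≉0 zero    = 1≉0
    pow≉0 q≉0 (suc m) = *≉0 q≉0 (pow≉0 q≉0 m)

    *-cancelˡ-≈0 : ∀ {a x} → ¬ a ≈ 0# → a * x ≈ 0# → x ≈ 0#
    *-cancelˡ-≈0 a≉0 ax≈0 = Sum.fromInj₂ (λ a≈0 → contradiction a≈0 a≉0) (noZeroDiv _ _ ax≈0)

module ProjectivePoints {c ℓ} (R : CommutativeRing c ℓ) where
  open CommutativeRing R hiding (zero)
  open RingDefs R
  open FinSum R
  open Arithmetic R
  open Tuples
  open Subsets
  open import Algebra.Properties.Ring ring using (-‿distribʳ-*; -‿involutive; -0#≈0#; +-inverseʳ-unique)
  open import Relation.Binary.Reasoning.Setoid setoid

  AtLeastProjPoints-≤1 : ∀ {q k N} → ¬ q ∣ 1# → N ≤ 1 → AtLeastProjPoints q (suc k) N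
  AtLeastProjPoints-≤1 q∤1 N≤1 = (λ _ _ → 1#) , (λ _ → zero , q∤1) , λ a b _ → unique N≤1 a b
    where
    unique : ∀ {N} → N ≤ 1 → (a b : Fin N) → a ≡ b
    unique (s≤s z≤n) zero zero = ≡.refl

  module _ {q} (q-prime : IsPrime q) {k n} (B : Inc (suc k) n) (ρ : Inc (suc k) n → Carrier)
           (q∤ρ : ∀ I → ¬ q ∣ ρ I) where
    open PlückerCoordinates R {k} {n}

    coord-∉ : ∀ {v} (S : Inc k n) → ¬ v ∈ᵛ proj₁ S → ¬ q ∣ coord ρ (v , S)
    coord-∉ {v} (T , incT) v∉T with v ∈ᵛ? T
    ... | yes v∈T = contradiction v∈T v∉T
    ... | no  _   = q∤ρ _ ∘ ∣-sign⁻¹ (toℕ (insertIndex v T))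

    plückerVector : Inc k n → Fin (suc k) → Carrier
    plückerVector S i = coord ρ (proj₁ B i , S)

    plückerVector-nonzeroModq : ∀ S → NonzeroModq q (plückerVector S)
    plückerVector-nonzeroModq S = Prod.map₂ (coord-∉ S) (increasing⇒∃∉ (proj₁ S) B)

    ρB : Carrier
    ρB = coord ρ (proj₁ B zero , tail (proj₁ B) , tail-increasing (proj₂ B))

    q∤ρB : ¬ q ∣ ρB
    q∤ρB = coord-∉ (tail (proj₁ B) , tail-increasing (proj₂ B)) λ (l , Bₗ₊₁≡B₀) →
      ℕₚ.<-irrefl (≡.cong toℕ (≡.sym Bₗ₊₁≡B₀)) (proj₂ B zero (suc l) (s≤s z≤n))

    coefficient : Fin n → Fin (suc k) → Carrier
    coefficient j i = sign (toℕ (suc i)) * coord ρ (dropAt B j (suc i))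

    linearForm : Fin n → Inc k n → Carrier
    linearForm j S = sumFin (suc k) (λ i → coefficient j i * plückerVector S i)

    module _ (plücker : ∀ j S → plückerRel ρ B j S ≈ 0#) where

      linearForm≈ : ∀ j S → linearForm j S ≈ - (ρB * coord ρ (j , S))
      linearForm≈ j S = +-inverseʳ-unique _ _ (trans
        (+-cong (sym (*-identityˡ _)) (sumFin-cong (suc k) λ i →
          *-assoc (sign (toℕ (suc i))) (coord ρ (dropAt B j (suc i))) (plückerVector S i)))
        (plücker j S))

      linearForm-∈ : ∀ {j} S → j ∈ᵛ proj₁ S → linearForm j S ≈ 0#
      linearForm-∈ {j} S j∈S = begin
        linearForm j S             ≈⟨ linearForm≈ j S ⟩
        - (ρB * coord ρ (j , S))   ≈⟨ -‿cong (*-congˡ (coord-∈ ρ S j∈S)) ⟩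
        - (ρB * 0#)                ≈⟨ -‿cong (zeroʳ ρB) ⟩
        - 0#                       ≈⟨ -0#≈0# ⟩
        0#                         ∎

      linearForm-sameLine : ∀ j S S′ λ′ → (∀ i → q ∣ (plückerVector S i - λ′ * plückerVector S′ i)) →
                            q ∣ (linearForm j S - λ′ * linearForm j S′)
      linearForm-sameLine j S S′ λ′ congruent = ∣-resp-≈
        (sumFin-*-[x-λy] (suc k) (coefficient j) (plückerVector S) (plückerVector S′) λ′)
        (∣-sumFin (suc k) (λ i → coefficient j i * (plückerVector S i - λ′ * plückerVector S′ i))
                          (λ i → ∣-*ˡ (coefficient j i) (congruent i)))

      plückerVector-separates : ∀ {S S′ j} → Separates (proj₁ S) (proj₁ S′) j →
                                ¬ SameLineModq q (plückerVector S) (plückerVector S′)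
      plückerVector-separates {S} {S′} {j} (inj₁ (j∈S , j∉S′)) (λ′ , q∤λ′ , congruent) =
        prime∤* q-prime q∤λ′ (prime∤* q-prime q∤ρB (coord-∉ S′ j∉S′))
          (∣-resp-≈ difference≈ (linearForm-sameLine j S S′ λ′ congruent))
        where
        y : Carrier
        y = coord ρ (j , S′)
        difference≈ : linearForm j S - λ′ * linearForm j S′ ≈ λ′ * (ρB * y)
        difference≈ = begin
          linearForm j S - λ′ * linearForm j S′
            ≈⟨ +-cong (linearForm-∈ S j∈S) (-‿cong (*-congˡ (linearForm≈ j S′))) ⟩
          0# + - (λ′ * - (ρB * y))   ≈⟨ +-identityˡ _ ⟩
          - (λ′ * - (ρB * y))        ≈⟨ -‿cong (-‿distribʳ-* λ′ (ρB * y)) ⟨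
          - - (λ′ * (ρB * y))        ≈⟨ -‿involutive _ ⟩
          λ′ * (ρB * y)              ∎
      plückerVector-separates {S} {S′} {j} (inj₂ (j∉S , j∈S′)) (λ′ , q∤λ′ , congruent) =
        prime∤* q-prime q∤ρB (coord-∉ S j∉S)
          (∣-neg⁻¹ (∣-resp-≈ difference≈ (linearForm-sameLine j S S′ λ′ congruent)))
        where
        difference≈ : linearForm j S - λ′ * linearForm j S′ ≈ - (ρB * coord ρ (j , S))
        difference≈ = begin
          linearForm j S - λ′ * linearForm j S′
            ≈⟨ +-cong (linearForm≈ j S) (-‿cong (*-congˡ (linearForm-∈ S′ j∈S′))) ⟩
          - (ρB * coord ρ (j , S)) + - (λ′ * 0#)   ≈⟨ +-congˡ (trans (-‿cong (zeroʳ λ′)) -0#≈0#) ⟩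
          - (ρB * coord ρ (j , S)) + 0#            ≈⟨ +-identityʳ _ ⟩
          - (ρB * coord ρ (j , S))                 ∎

      plückerVectors-distinct : AtLeastProjPoints q (suc k) (binom n k)
      plückerVectors-distinct = L , plückerVector-nonzeroModq ∘ subsets n k , injective
        where
        L : Fin (binom n k) → Fin (suc k) → Carrier
        L a = plückerVector (subsets n k a)
        injective : ∀ a b → SameLineModq q (L a) (L b) → a ≡ b
        injective a b sameLine with a Finₚ.≟ b
        ... | yes a≡b = a≡b
        ... | no  a≢b = contradiction sameLine (plückerVector-separates (proj₂ (subsets-separated n k a≢b)))

module Homomorphism {c ℓ c′ ℓ′} {R : CommutativeRing c ℓ} {K : CommutativeRing c′ ℓ′}
  {ι : CommutativeRing.Carrier R → CommutativeRing.Carrier K}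
  (ι-hom : IsRingHomomorphism (CommutativeRing.rawRing R) (CommutativeRing.rawRing K) ι) where
  private
    module R where
      open CommutativeRing R public
      open RingDefs R public
      open PlückerCoordinates R public
    module K where
      open CommutativeRing K public
      open RingDefs K public
      open FinSum K public
      open PlückerCoordinates K public
  open IsRingHomomorphism ι-hom
  open Tuples using (_∈ᵛ?_; insertIndex)

  ι-sign : ∀ m → ι (R.sign m) K.≈ K.sign m
  ι-sign zero    = 1#-homo
  ι-sign (suc m) = K.trans (-‿homo _) (K.-‿cong (ι-sign m))

  ι-sumFin : ∀ m (f : Fin m → R.Carrier) → ι (R.sumFin m f) K.≈ K.sumFin m (ι ∘ f)
  ι-sumFin zero    f = 0#-homo
  ι-sumFin (suc m) f = K.trans (+-homo _ _) (K.+-congˡ (ι-sumFin m (f ∘ suc)))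

  ι-coord : ∀ {k n} ρ (x : Fin n × Inc k n) → ι (R.coord ρ x) K.≈ K.coord (ι ∘ ρ) x
  ι-coord ρ (v , T , incT) with v ∈ᵛ? T
  ... | yes _ = 0#-homo
  ... | no  _ = K.trans (*-homo _ _) (K.*-congʳ (ι-sign (toℕ (insertIndex v T))))

  ι-plückerRel : ∀ {k n} ρ (B : Inc (suc k) n) j S →
                 ι (R.plückerRel ρ B j S) K.≈ K.plückerRel (ι ∘ ρ) B j S
  ι-plückerRel {k} ρ B j S =
    K.trans (ι-sumFin (suc (suc k)) (R.plückerTerm ρ B j S)) (K.sumFin-cong (suc (suc k)) λ c →
      K.trans (*-homo _ _) (K.*-cong (ι-sign (toℕ c))
        (K.trans (*-homo _ _) (K.*-cong (ι-coord ρ (R.dropAt B j c)) (ι-coord ρ ((j ∷ proj₁ B) c , S))))))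

fractionField⇒isRingHomomorphism : ∀ {c ℓ c′ ℓ′} {R : CommutativeRing c ℓ} {K : CommutativeRing c′ ℓ′} {ι} →
  IsFractionField R K ι → IsRingHomomorphism (CommutativeRing.rawRing R) (CommutativeRing.rawRing K) ι
fractionField⇒isRingHomomorphism {R = R} {K} {ι} ff = record
  { isSemiringHomomorphism = record
    { isNearSemiringHomomorphism = record
      { +-isMonoidHomomorphism = record
        { isMagmaHomomorphism = record
          { isRelHomomorphism = record { cong = ι-cong }
          ; homo              = ι-+
          }
        ; ε-homo = ι-0
        }
      ; *-homo = ι-*
      }
    ; 1#-homo = ι-1
    }
  ; -‿homo = ι-neg
  }
  where
  module R = CommutativeRing R
  module K where
    open CommutativeRing K public
    open import Algebra.Properties.Ring ring public using (x+x≈x⇒x≈0; +-inverseˡ-unique)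
  open IsFractionField ff
  ι-0 : ι R.0# K.≈ K.0#
  ι-0 = K.x+x≈x⇒x≈0 _ (K.trans (K.sym (ι-+ R.0# R.0#)) (ι-cong (R.+-identityʳ R.0#)))
  ι-neg : ∀ a → ι (R.- a) K.≈ K.- ι a
  ι-neg a = K.+-inverseˡ-unique _ _ (K.trans (K.sym (ι-+ (R.- a) a)) (K.trans (ι-cong (R.-‿inverseˡ a)) ι-0))

module Specialization {c ℓ c′ ℓ′} {R : CommutativeRing c ℓ} {K : CommutativeRing c′ ℓ′}
  {ι : CommutativeRing.Carrier R → CommutativeRing.Carrier K} (ff : IsFractionField R K ι) {k n : ℕ} where
  private
    module R where
      open CommutativeRing R public
      open PlückerCoordinates R {k} {n} public
    module K where
      open CommutativeRing K public
      open RingDefs K public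
      open PlückerCoordinates K {k} {n} public
  open IsFractionField ff using (ι-inj)
  open IsRingHomomorphism (fractionField⇒isRingHomomorphism {R = R} {K} ff) using (0#-homo)
  open Homomorphism {R = R} {K} (fractionField⇒isRingHomomorphism ff) using (ι-plückerRel)

  IsSpecialization : (Inc (suc k) n → K.Carrier) → Set _
  IsSpecialization ψ = ∀ (f : Expr K.Carrier (Inc (suc k) n)) →
    (∀ (X : Fin (suc k) → Fin n → K.Carrier) → K.eval (K.minor X) f K.≈ K.0#) → K.eval ψ f K.≈ K.0#

  specialization⇒plücker : ∀ (p : Inc (suc k) n → R.Carrier) → IsSpecialization (ι ∘ p) →
                           ∀ B j S → R.plückerRel p B j S R.≈ R.0#
  specialization⇒plücker p ψ B j S = ι-inj (K.trans (ι-plückerRel p B j S) (K.trans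
    (K.reflexive (≡.sym (K.eval-plückerExpr (ι ∘ p) B j S)))
    (K.trans (ψ (K.plückerExpr B j S) (λ X → K.trans (K.reflexive (K.eval-plückerExpr (K.minor X) B j S))
                                                    (K.plückerRel-minor X B j S)))
             (K.sym 0#-homo))))

open Subsets using (initialSegment; binom; binom≡C; binom-≤1)

proposition4p7 :
    ∀ {c ℓ c′ ℓ′} (R : CommutativeRing c ℓ) (K : CommutativeRing c′ ℓ′)
      (ι : CommutativeRing.Carrier R → CommutativeRing.Carrier K) →
    RingDefs.IsPID R → IsFractionField R K ι →
    (q : CommutativeRing.Carrier R) → RingDefs.IsPrime R q →
    (k n : ℕ) → 1 ≤ k →
    (p : Inc k n → CommutativeRing.Carrier R) →
    (∀ I → ¬ (CommutativeRing._≈_ R (p I) (CommutativeRing.0# R))) →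
    (∀ (f : Expr (CommutativeRing.Carrier K) (Inc k n)) →
       (∀ (X : Fin k → Fin n → CommutativeRing.Carrier K) →
          CommutativeRing._≈_ K (RingDefs.eval K (RingDefs.minor K X) f) (CommutativeRing.0# K)) →
       CommutativeRing._≈_ K (RingDefs.eval K (λ I → ι (p I)) f) (CommutativeRing.0# K)) →
    (∃ λ m → ∀ I → RingDefs.ValEq R q (p I) m) →
    RingDefs.AtLeastProjPoints R q k (n C (k ∸ 1))
proposition4p7 R K ι pid ff q q-prime (suc k) n (s≤s z≤n) p _ ψ (m , ν[p]≡m) =
  ≡.subst (AtLeastProjPoints q (suc k)) (binom≡C n k) points
  where
  open CommutativeRing R hiding (zero)
  open RingDefs R
  open Arithmetic R
  open ProjectivePoints R
  open PlückerCoordinates R using (plückerRel; plückerRel-scale)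
  open Specialization ff using (specialization⇒plücker)
  open IsPID pid using (isIntegralDomain)
  open IsPrime q-prime using (nonzero)

  p′ : Inc (suc k) n → Carrier
  p′ I = proj₁ (valuation-factor q-prime (ν[p]≡m I))

  p≈qᵐp′ : ∀ I → p I ≈ pow q m * p′ I
  p≈qᵐp′ I = proj₁ (proj₂ (valuation-factor q-prime (ν[p]≡m I)))

  q∤p′ : ∀ I → ¬ q ∣ p′ I
  q∤p′ I = proj₂ (proj₂ (valuation-factor q-prime (ν[p]≡m I)))

  qᵐ≉0 : ¬ pow q m ≈ 0#
  qᵐ≉0 = pow≉0 isIntegralDomain nonzero m

  plücker′ : ∀ B j S → plückerRel p′ B j S ≈ 0#
  plücker′ B j S = *-cancelˡ-≈0 isIntegralDomain (*≉0 isIntegralDomain qᵐ≉0 qᵐ≉0)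
    (trans (sym (plückerRel-scale (pow q m) p≈qᵐp′ B j S)) (specialization⇒plücker p ψ B j S))

  points : AtLeastProjPoints q (suc k) (binom n k)
  points with suc k ℕₚ.≤? n
  ... | yes k≤n = plückerVectors-distinct q-prime (initialSegment k≤n) p′ q∤p′ (plücker′ (initialSegment k≤n))
  ... | no  k≰n = AtLeastProjPoints-≤1 (prime∤1 q-prime) (binom-≤1 (ℕₚ.≤-pred (ℕₚ.≰⇒> k≰n)))
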